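{- Let $(P_n)_{n\ge 0}$ be the Pell sequence, $P_0=0$, $P_1=1$, $P_{n+1}=2P_n+P_{n-1}$, and let $\alpha=1+\sqrt{2}$. For a prime $p$, let $z(p)$ be the smallest positive integer $k$ such that $p\mid P_k$, and let $e_p=\nu_p(P_{z(p)})$ be the exponent of $p$ in the prime factorization of $P_{z(p)}$. Then for every prime $p$, $$e_p\le \frac{(p+1)\log\alpha}{2\log p}.$$
   Context: $\nu_p(m)$ denotes the exponent of the prime $p$ in the factorization of the nonzero integer $m$; $\log$ is the natural logarithm. The order of appearance $z(p)$ exists for every prime $p$. -}

module Defs where

open import Data.Nat using (ℕ; zero; suc; _+_; _*_; _∸_; _^_; _≤_; _<_)
open import Data.Nat.Divisibility using (_∣_)
open import Data.Product using (_×_; _,_)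
open import Data.Sum using (_⊎_)
open import Relation.Nullary using (¬_)

Pell : ℕ → ℕ
Pell zero = 0
Pell (suc zero) = 1
Pell (suc (suc n)) = 2 * Pell (suc n) + Pell n

IsOrderOfAppearance : ℕ → ℕ → Set
IsOrderOfAppearance p k =
  (0 < k) × (p ∣ Pell k) × (∀ j → 0 < j → j < k → ¬ (p ∣ Pell j))

-- ν_p(m) = e : p^e ∣ m and p^(e+1) ∤ m   (m nonzero)
IsValuation : ℕ → ℕ → ℕ → Set
IsValuation p m e = (p ^ e ∣ m) × ¬ (p ^ suc e ∣ m)

-- Elements a + b√2 of ℕ[√2], with a,b ∈ ℕ, represented by pairs (a , b).
-- alphaPow n = α^n where α = 1 + √2, computed by repeated multiplication:
-- (a + b√2)(1 + √2) = (a + 2b) + (a + b)√2.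
alphaPow : ℕ → ℕ × ℕ
alphaPow zero = 1 , 0
alphaPow (suc n) with alphaPow n
... | a , b = a + 2 * b , a + b

-- The real-number order x ≤ a + b√2 for x, a, b ∈ ℕ:
-- either x ≤ a, or x > a and (x - a)² ≤ 2 b².
_≤ℕ√2_ : ℕ → ℕ × ℕ → Set
x ≤ℕ√2 (a , b) = (x ≤ a) ⊎ ((a < x) × ((x ∸ a) ^ 2 ≤ 2 * b ^ 2))

{-# OPTIONS --safe #-}
-- Write α^n = H n + P n √2, where P = Pell. For an odd prime p, expanding (1 + √2)^p by
-- the binomial theorem gives H p ≡ 1 (mod p), and the Cassini-type identity
-- 2 P(p-1) P(p+1) + 1 = (H p)² then shows that p divides P(2m) for some 0 < m with
-- 2m ≤ p + 1. Because H n and P n are coprime and P(m + n) = H m P n + P m H n, the order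
-- of appearance z satisfies z ≤ m or z = 2m. If z ≤ m then p^e ≤ P z ≤ P m ≤ H m; if
-- z = 2m then P z = 2 H m P m with p ∤ 2 P m, so p^e ∣ H m. Either way
-- p^(2e) ≤ (H m)² ≤ H(2m) ≤ H(p + 1). For p = 2 one has z = 2 and 2^(2e) ≤ 4 ≤ H 3 = 7.
module Submission where

open import Defs
open import Data.Nat using (ℕ; _^_; _*_; _+_)
open import Data.Nat.Primality using (Prime)
open import Data.Nat.Base
  using (zero; suc; _∸_; _≤_; _<_; _≤′_; ≤′-refl; ≤′-step; z≤n; s≤s; z<s; _!; nonTrivial⇒≢1; >-nonZero)
open import Data.Nat.Properties
open import Data.Nat.Divisibility
open import Data.Nat.DivMod using (_/_; m/n*n≡m)
open import Data.Nat.Coprimality using (Coprime; coprime-divisor)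
open import Data.Nat.Combinatorics
  using (_C_; nCk≡n!/k![n-k]!; k![n∸k]!∣n!; nCk+nC[k+1]≡[n+1]C[k+1]; k>n⇒nCk≡0; nCn≡1)
open import Data.Nat.Primality
  using (euclidsLemma; prime⇒nonZero; prime⇒nonTrivial; prime⇒irreducible; prime[2])
open import Data.Nat.Tactic.RingSolver using (solve-∀)
open import Data.Fin.Base using (zero; suc; toℕ; inject₁; fromℕ)
open import Data.Fin.Properties using (toℕ-inject₁; toℕ-fromℕ; toℕ<n)
open import Data.Vec.Functional using (Vector; init; last; tail; map)
open import Algebra.Properties.Semiring.Sum +-*-semiring
  using (sum; sum⁺-syntax; sum-cong-≗; ∑-distrib-+; sum-init-last; *-distribˡ-sum)
open import Data.Product using (_,_; proj₁; proj₂; ∃-syntax)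
open import Data.Sum using (_⊎_; inj₁; inj₂)
import Data.Sum as Sum
open import Data.Empty using (⊥-elim)
open import Function using (_∘_)
open import Relation.Nullary using (¬_; yes; no)
open import Relation.Binary.Definitions using (tri<; tri≈; tri>)
open import Relation.Binary.PropositionalEquality
open ≡-Reasoning

H : ℕ → ℕ
H n = proj₁ (alphaPow n)

proj₂-alphaPow : ∀ n → proj₂ (alphaPow n) ≡ Pell n
proj₂-alphaPow zero = refl
proj₂-alphaPow (suc zero) = refl
proj₂-alphaPow (suc (suc n)) = begin
  proj₂ (alphaPow (suc (suc n)))   ≡⟨ solve (H n) (proj₂ (alphaPow n)) ⟩
  2 * proj₂ (alphaPow (suc n)) + proj₂ (alphaPow n)
    ≡⟨ cong₂ (λ x y → 2 * x + y) (proj₂-alphaPow (suc n)) (proj₂-alphaPow n) ⟩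
  Pell (suc (suc n))               ∎
  where
  solve : ∀ a b → (a + 2 * b) + (a + b) ≡ 2 * (a + b) + b
  solve = solve-∀

H-suc : ∀ n → H (suc n) ≡ H n + 2 * Pell n
H-suc n = cong (λ b → H n + 2 * b) (proj₂-alphaPow n)

Pell-suc : ∀ n → Pell (suc n) ≡ H n + Pell n
Pell-suc n = trans (sym (proj₂-alphaPow (suc n))) (cong (H n +_) (proj₂-alphaPow n))

H-suc≡Pell-suc+Pell : ∀ n → H (suc n) ≡ Pell (suc n) + Pell n
H-suc≡Pell-suc+Pell n = begin
  H (suc n)                   ≡⟨ H-suc n ⟩
  H n + 2 * Pell n            ≡⟨ solve (H n) (Pell n) ⟩
  (H n + Pell n) + Pell n     ≡⟨ cong (_+ Pell n) (sym (Pell-suc n)) ⟩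
  Pell (suc n) + Pell n       ∎
  where
  solve : ∀ a b → a + 2 * b ≡ (a + b) + b
  solve = solve-∀

H-+ : ∀ m n → H (m + n) ≡ H m * H n + 2 * (Pell m * Pell n)
Pell-+ : ∀ m n → Pell (m + n) ≡ H m * Pell n + Pell m * H n
H-+ zero n = sym (trans (+-identityʳ _) (+-identityʳ (H n)))
H-+ (suc m) n = begin
  H (suc m + n)                          ≡⟨ H-suc (m + n) ⟩
  H (m + n) + 2 * Pell (m + n)           ≡⟨ cong₂ (λ x y → x + 2 * y) (H-+ m n) (Pell-+ m n) ⟩
  (H m * H n + 2 * (Pell m * Pell n)) + 2 * (H m * Pell n + Pell m * H n)
    ≡⟨ solve (H m) (Pell m) (H n) (Pell n) ⟩
  (H m + 2 * Pell m) * H n + 2 * ((H m + Pell m) * Pell n)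
    ≡⟨ sym (cong₂ (λ x y → x * H n + 2 * (y * Pell n)) (H-suc m) (Pell-suc m)) ⟩
  H (suc m) * H n + 2 * (Pell (suc m) * Pell n) ∎
  where
  solve : ∀ a b c d → (a * c + 2 * (b * d)) + 2 * (a * d + b * c) ≡ (a + 2 * b) * c + 2 * ((a + b) * d)
  solve = solve-∀
Pell-+ zero n = sym (trans (+-identityʳ _) (+-identityʳ (Pell n)))
Pell-+ (suc m) n = begin
  Pell (suc m + n)                       ≡⟨ Pell-suc (m + n) ⟩
  H (m + n) + Pell (m + n)               ≡⟨ cong₂ _+_ (H-+ m n) (Pell-+ m n) ⟩
  (H m * H n + 2 * (Pell m * Pell n)) + (H m * Pell n + Pell m * H n)
    ≡⟨ solve (H m) (Pell m) (H n) (Pell n) ⟩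
  (H m + 2 * Pell m) * Pell n + (H m + Pell m) * H n
    ≡⟨ sym (cong₂ (λ x y → x * Pell n + y * H n) (H-suc m) (Pell-suc m)) ⟩
  H (suc m) * Pell n + Pell (suc m) * H n ∎
  where
  solve : ∀ a b c d → (a * c + 2 * (b * d)) + (a * d + b * c) ≡ (a + 2 * b) * d + (a + b) * c
  solve = solve-∀

Pell-double : ∀ m → Pell (m + m) ≡ Pell m * (2 * H m)
Pell-double m = trans (Pell-+ m m) (solve (H m) (Pell m))
  where
  solve : ∀ a b → a * b + b * a ≡ b * (2 * a)
  solve = solve-∀

-- The norm a² − 2b² of α^n alternates in sign, written without subtraction.
H-Pell-consecutive : ∀ n →
  H n * H n + H (suc n) * H (suc n) ≡ 2 * (Pell n * Pell n) + 2 * (Pell (suc n) * Pell (suc n))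
H-Pell-consecutive n = begin
  H n * H n + H (suc n) * H (suc n)
    ≡⟨ cong (λ x → H n * H n + x * x) (H-suc n) ⟩
  H n * H n + (H n + 2 * Pell n) * (H n + 2 * Pell n)
    ≡⟨ solve (H n) (Pell n) ⟩
  2 * (Pell n * Pell n) + 2 * ((H n + Pell n) * (H n + Pell n))
    ≡⟨ cong (λ x → 2 * (Pell n * Pell n) + 2 * (x * x)) (sym (Pell-suc n)) ⟩
  2 * (Pell n * Pell n) + 2 * (Pell (suc n) * Pell (suc n)) ∎
  where
  solve : ∀ a b → a * a + (a + 2 * b) * (a + 2 * b) ≡ 2 * (b * b) + 2 * ((a + b) * (a + b))
  solve = solve-∀

x+y≡u+v∧x≡u+1⇒y+1≡v : ∀ {x y u v} → x + y ≡ u + v → x ≡ u + 1 → y + 1 ≡ v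
x+y≡u+v∧x≡u+1⇒y+1≡v {y = y} {u} {v} eq refl =
  +-cancelˡ-≡ u _ _ (trans (solve u y) eq)
  where
  solve : ∀ u y → u + (y + 1) ≡ u + 1 + y
  solve = solve-∀

x+y≡u+v∧x+1≡u⇒y≡v+1 : ∀ {x y u v} → x + y ≡ u + v → x + 1 ≡ u → y ≡ v + 1
x+y≡u+v∧x+1≡u⇒y≡v+1 {x} {y} {v = v} eq refl =
  +-cancelˡ-≡ x _ _ (trans eq (solve x v))
  where
  solve : ∀ x v → x + 1 + v ≡ x + (v + 1)
  solve = solve-∀

H-Pell-norm-even : ∀ h → H (h + h) * H (h + h) ≡ 2 * (Pell (h + h) * Pell (h + h)) + 1
H-Pell-norm-odd : ∀ h → H (suc (h + h)) * H (suc (h + h)) + 1 ≡ 2 * (Pell (suc (h + h)) * Pell (suc (h + h)))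
H-Pell-norm-even zero = refl
H-Pell-norm-even (suc h) rewrite +-suc h h =
  x+y≡u+v∧x+1≡u⇒y≡v+1 (H-Pell-consecutive (suc (h + h))) (H-Pell-norm-odd h)
H-Pell-norm-odd h = x+y≡u+v∧x≡u+1⇒y+1≡v (H-Pell-consecutive (h + h)) (H-Pell-norm-even h)

Pell-cassini-odd : ∀ h →
  2 * (Pell (h + h) * Pell (suc (suc (h + h)))) + 1 ≡ H (suc (h + h)) * H (suc (h + h))
Pell-cassini-odd h =
  subst (λ d → 2 * (Pell n * d) + 1 ≡ H (suc n) * H (suc n)) (sym (Pell-suc (suc n)))
    (from-norm {H (suc n)} {Pell (suc n)} {Pell n} (H-suc≡Pell-suc+Pell n) (H-Pell-norm-odd h))
  where
  n : ℕ
  n = h + h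
  -- c = a − b, so 2 c (a + b) = 2a² − 2b² = a² − 1.
  from-norm : ∀ {a b c} → a ≡ b + c → a * a + 1 ≡ 2 * (b * b) → 2 * (c * (a + b)) + 1 ≡ a * a
  from-norm {b = b} {c} refl a²+1≡2b² = +-cancelʳ-≡ (b * b) _ _ (begin
    2 * (c * ((b + c) + b)) + 1 + b * b                 ≡⟨ solve₁ b c ⟩
    ((b + c) * (b + c) + 1) + (2 * (b * c) + c * c)     ≡⟨ cong (_+ (2 * (b * c) + c * c)) a²+1≡2b² ⟩
    2 * (b * b) + (2 * (b * c) + c * c)                 ≡⟨ solve₂ b c ⟩
    (b + c) * (b + c) + b * b                           ∎)
    where
    solve₁ : ∀ b c → 2 * (c * ((b + c) + b)) + 1 + b * b ≡ ((b + c) * (b + c) + 1) + (2 * (b * c) + c * c)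
    solve₁ = solve-∀
    solve₂ : ∀ b c → 2 * (b * b) + (2 * (b * c) + c * c) ≡ (b + c) * (b + c) + b * b
    solve₂ = solve-∀

H-Pell-coprime : ∀ n → Coprime (H n) (Pell n)
H-Pell-coprime zero (i∣1 , _) = ∣1⇒≡1 i∣1
H-Pell-coprime (suc n) {i} (i∣H[n+1] , i∣Pell[n+1]) = H-Pell-coprime n (i∣H[n] , i∣Pell[n])
  where
  i∣Pell[n] : i ∣ Pell n
  i∣Pell[n] = ∣m+n∣m⇒∣n (subst (i ∣_) (H-suc≡Pell-suc+Pell n) i∣H[n+1]) i∣Pell[n+1]
  i∣H[n] : i ∣ H n
  i∣H[n] = ∣m+n∣m⇒∣n (subst (i ∣_) (trans (Pell-suc n) (+-comm (H n) (Pell n))) i∣Pell[n+1]) i∣Pell[n]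

Pell-∣-+ : ∀ {d} m {n} → d ∣ Pell n → d ∣ Pell (m + n) → d ∣ Pell m
Pell-∣-+ {d} m {n} d∣Pell[n] d∣Pell[m+n] = coprime-divisor d⊥H[n] d∣H[n]*Pell[m]
  where
  d⊥H[n] : Coprime d (H n)
  d⊥H[n] (i∣d , i∣H[n]) = H-Pell-coprime n (i∣H[n] , ∣-trans i∣d d∣Pell[n])
  d∣H[n]*Pell[m] : d ∣ H n * Pell m
  d∣H[n]*Pell[m] = subst (d ∣_) (*-comm (Pell m) (H n))
    (∣m+n∣m⇒∣n (subst (d ∣_) (Pell-+ m n) d∣Pell[m+n]) (∣-trans d∣Pell[n] (n∣m*n (H m))))

mono-≤ : (f : ℕ → ℕ) → (∀ n → f n ≤ f (suc n)) → ∀ {m n} → m ≤ n → f m ≤ f n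
mono-≤ f step m≤n = go (≤⇒≤′ m≤n)
  where
  go : ∀ {m n} → m ≤′ n → f m ≤ f n
  go ≤′-refl = ≤-refl
  go (≤′-step m≤′n) = ≤-trans (go m≤′n) (step _)

H-mono-≤ : ∀ {m n} → m ≤ n → H m ≤ H n
H-mono-≤ = mono-≤ H (λ n → subst (H n ≤_) (sym (H-suc n)) (m≤m+n (H n) _))

Pell-mono-≤ : ∀ {m n} → m ≤ n → Pell m ≤ Pell n
Pell-mono-≤ = mono-≤ Pell (λ n → subst (Pell n ≤_) (sym (Pell-suc n)) (m≤n+m (Pell n) _))

Pell≤H : ∀ n → Pell n ≤ H n
Pell≤H zero = z≤n
Pell≤H (suc n) = subst₂ _≤_ (sym (Pell-suc n)) (sym (H-suc n)) (+-monoʳ-≤ (H n) (m≤m+n (Pell n) _))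

H-pos : ∀ n → 0 < H n
H-pos n = H-mono-≤ {0} {n} z≤n

Pell-pos : ∀ {n} → 0 < n → 0 < Pell n
Pell-pos {suc n} _ = subst (0 <_) (sym (Pell-suc n)) (≤-trans (H-pos n) (m≤m+n (H n) _))

prime⇒≢1 : ∀ {p} → Prime p → p ≢ 1
prime⇒≢1 pr = nonTrivial⇒≢1 {{prime⇒nonTrivial pr}}

prime∤! : ∀ {p m} → Prime p → m < p → ¬ p ∣ m !
prime∤! {m = zero} pr _ p∣1 = prime⇒≢1 pr (∣1⇒≡1 p∣1)
prime∤! {m = suc m} pr m<p p∣m! with euclidsLemma (suc m) (m !) pr p∣m!
... | inj₁ p∣1+m = <⇒≱ m<p (∣⇒≤ p∣1+m)
... | inj₂ p∣m!′ = prime∤! pr (<-trans (n<1+n m) m<p) p∣m!′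

n!≡nCk*[k!*[n∸k]!] : ∀ {n k} → k ≤ n → n ! ≡ (n C k) * (k ! * (n ∸ k) !)
n!≡nCk*[k!*[n∸k]!] {n} {k} k≤n = sym (begin
  (n C k) * (k ! * (n ∸ k) !)                       ≡⟨ cong (_* (k ! * (n ∸ k) !)) (nCk≡n!/k![n-k]! k≤n) ⟩
  (n ! / (k ! * (n ∸ k) !)) * (k ! * (n ∸ k) !)     ≡⟨ m/n*n≡m (k![n∸k]!∣n! k≤n) ⟩
  n !                                               ∎)
  where instance _ = k !* (n ∸ k) !≢0

p∣pCk : ∀ {p k} → Prime p → 0 < k → k < p → p ∣ p C k
p∣pCk {p@(suc q)} {k} pr 0<k k<p with euclidsLemma (p C k) (k ! * (p ∸ k) !) pr p∣pCk*d
  where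
  p∣pCk*d : p ∣ (p C k) * (k ! * (p ∸ k) !)
  p∣pCk*d = subst (p ∣_) (n!≡nCk*[k!*[n∸k]!] (<⇒≤ k<p)) (m∣m*n (q !))
... | inj₁ p∣pCk = p∣pCk
... | inj₂ p∣d with euclidsLemma (k !) ((p ∸ k) !) pr p∣d
...   | inj₁ p∣k! = ⊥-elim (prime∤! pr k<p p∣k!)
...   | inj₂ p∣[p∸k]! = ⊥-elim (prime∤! pr (∸-monoʳ-< 0<k (<⇒≤ k<p)) p∣[p∸k]!)

binomialSum : ℕ → (ℕ → ℕ) → ℕ
binomialSum n w = ∑[ i ≤ n ] ((n C toℕ i) * w (toℕ i))

binomialSum-suc : ∀ n w → binomialSum (suc n) w ≡ binomialSum n w + binomialSum n (w ∘ suc)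
binomialSum-suc n w = begin
  w₀ + ∑[ j ≤ n ] ((suc n C suc (toℕ j)) * w (suc (toℕ j)))
    ≡⟨ cong (w₀ +_) (sum-cong-≗ {suc n} {λ j → (suc n C suc (toℕ j)) * w (suc (toℕ j))} pascal) ⟩
  w₀ + ∑[ j ≤ n ] (f j + g j)                 ≡⟨ cong (w₀ +_) (∑-distrib-+ f g) ⟩
  w₀ + (sum f + sum g)                        ≡⟨ cong (λ x → w₀ + (sum f + x)) (sum-init-last g) ⟩
  w₀ + (sum f + (sum (init g) + last g))
    ≡⟨ cong₂ (λ x y → w₀ + (sum f + (x + y))) (sum-cong-≗ {n} {init g} {g′} reindex) last≡0 ⟩
  w₀ + (sum f + (sum g′ + 0))                 ≡⟨ solve w₀ (sum f) (sum g′) ⟩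
  (w₀ + sum g′) + sum f                       ∎
  where
  w₀ : ℕ
  w₀ = (n C 0) * w 0
  f g : Vector ℕ (suc n)
  f j = (n C toℕ j) * w (suc (toℕ j))
  g j = (n C suc (toℕ j)) * w (suc (toℕ j))
  g′ : Vector ℕ n
  g′ j = (n C suc (toℕ j)) * w (suc (toℕ j))
  pascal : ∀ j → (suc n C suc (toℕ j)) * w (suc (toℕ j)) ≡ f j + g j
  pascal j = trans (cong (_* w (suc (toℕ j))) (sym (nCk+nC[k+1]≡[n+1]C[k+1] n (toℕ j))))
                   (*-distribʳ-+ (w (suc (toℕ j))) (n C toℕ j) (n C suc (toℕ j)))
  reindex : ∀ j → init g j ≡ g′ j
  reindex j = cong (λ i → (n C suc i) * w (suc i)) (toℕ-inject₁ j)
  last≡0 : last g ≡ 0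
  last≡0 = cong (_* w (suc (toℕ (fromℕ n)))) (k>n⇒nCk≡0 (s≤s (≤-reflexive (sym (toℕ-fromℕ n)))))
  solve : ∀ a b c → a + (b + (c + 0)) ≡ a + c + b
  solve = solve-∀

binomialSum-*ˡ : ∀ n c w → binomialSum n (λ k → c * w k) ≡ c * binomialSum n w
binomialSum-*ˡ n c w = begin
  binomialSum n (λ k → c * w k)
    ≡⟨ sum-cong-≗ {suc n} {λ i → (n C toℕ i) * (c * w (toℕ i))} {map (c *_) t} (λ i → solve (n C toℕ i) c (w (toℕ i))) ⟩
  sum (map (c *_) t)             ≡⟨ sym (*-distribˡ-sum c t) ⟩
  c * sum t                      ∎
  where
  t : Vector ℕ (suc n)
  t i = (n C toℕ i) * w (toℕ i)
  solve : ∀ a c x → a * (c * x) ≡ c * (a * x)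
  solve = solve-∀

∣-sum : ∀ {d n} (f : Vector ℕ n) → (∀ i → d ∣ f i) → d ∣ sum f
∣-sum {n = zero} f _ = _ ∣0
∣-sum {n = suc n} f d∣f = ∣m∣n⇒∣m+n (d∣f zero) (∣-sum (tail f) (d∣f ∘ suc))

binomialSum-prime : ∀ {p} → Prime p → ∀ w → ∃[ c ] binomialSum p w ≡ w 0 + c * p + w p
binomialSum-prime {suc q} pr w = quotient p∣S , (begin
  (1 * w 0) + sum g                      ≡⟨ cong (1 * w 0 +_) (sum-init-last g) ⟩
  (1 * w 0) + (sum (init g) + last g)    ≡⟨ cong₂ (λ x y → 1 * w 0 + (x + y)) (m∣n⇒n≡quotient*m p∣S) last≡w[p] ⟩
  (1 * w 0) + (c * suc q + w (suc q))    ≡⟨ solve (w 0) (c * suc q) (w (suc q)) ⟩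
  w 0 + c * suc q + w (suc q)            ∎)
  where
  g : Vector ℕ (suc q)
  g j = (suc q C suc (toℕ j)) * w (suc (toℕ j))
  p∣S : suc q ∣ sum (init g)
  p∣S = ∣-sum (init g) (λ j → ∣-trans (p∣pCk pr z<s (s≤s (subst (_< q) (sym (toℕ-inject₁ j)) (toℕ<n j)))) (m∣m*n _))
  c : ℕ
  c = quotient p∣S
  last≡w[p] : last g ≡ w (suc q)
  last≡w[p] rewrite toℕ-fromℕ q | nCn≡1 (suc q) = +-identityʳ _
  solve : ∀ a b c → 1 * a + (b + c) ≡ a + b + c
  solve = solve-∀

-- (√2)^k = √2^₁ k + √2^₂ k · √2
√2^₁ √2^₂ : ℕ → ℕ
√2^₁ zero = 1
√2^₁ (suc k) = 2 * √2^₂ k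
√2^₂ zero = 0
√2^₂ (suc k) = √2^₁ k

H≡binomialSum : ∀ n → H n ≡ binomialSum n √2^₁
Pell≡binomialSum : ∀ n → Pell n ≡ binomialSum n √2^₂
H≡binomialSum zero = refl
H≡binomialSum (suc n) = begin
  H (suc n)                                       ≡⟨ H-suc n ⟩
  H n + 2 * Pell n                                ≡⟨ cong₂ (λ x y → x + 2 * y) (H≡binomialSum n) (Pell≡binomialSum n) ⟩
  binomialSum n √2^₁ + 2 * binomialSum n √2^₂     ≡⟨ cong (binomialSum n √2^₁ +_) (sym (binomialSum-*ˡ n 2 √2^₂)) ⟩
  binomialSum n √2^₁ + binomialSum n (√2^₁ ∘ suc) ≡⟨ sym (binomialSum-suc n √2^₁) ⟩
  binomialSum (suc n) √2^₁                        ∎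
Pell≡binomialSum zero = refl
Pell≡binomialSum (suc n) = begin
  Pell (suc n)                                    ≡⟨ Pell-suc n ⟩
  H n + Pell n                                    ≡⟨ cong₂ _+_ (H≡binomialSum n) (Pell≡binomialSum n) ⟩
  binomialSum n √2^₁ + binomialSum n √2^₂         ≡⟨ +-comm (binomialSum n √2^₁) _ ⟩
  binomialSum n √2^₂ + binomialSum n (√2^₂ ∘ suc) ≡⟨ sym (binomialSum-suc n √2^₂) ⟩
  binomialSum (suc n) √2^₂                        ∎

√2^₁-odd≡0 : ∀ h → √2^₁ (suc (h + h)) ≡ 0
√2^₁-odd≡0 zero = refl
√2^₁-odd≡0 (suc h) rewrite +-suc h h = cong (2 *_) (√2^₁-odd≡0 h)

H-odd-prime : ∀ h → Prime (suc (h + h)) → ∃[ c ] H (suc (h + h)) ≡ 1 + c * suc (h + h)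
H-odd-prime h pr = c , (begin
  H p                          ≡⟨ H≡binomialSum p ⟩
  binomialSum p √2^₁           ≡⟨ proj₂ (binomialSum-prime pr √2^₁) ⟩
  1 + c * p + √2^₁ p           ≡⟨ cong (1 + c * p +_) (√2^₁-odd≡0 h) ⟩
  1 + c * p + 0                ≡⟨ +-identityʳ _ ⟩
  1 + c * p                    ∎)
  where
  p c : ℕ
  p = suc (h + h)
  c = proj₁ (binomialSum-prime pr √2^₁)

x≡1+c*p∧y+1≡x*x⇒p∣y : ∀ {p c x y} → x ≡ 1 + c * p → y + 1 ≡ x * x → p ∣ y
x≡1+c*p∧y+1≡x*x⇒p∣y {p} {c} {x} {y} refl y+1≡x² = divides (c * (2 + c * p)) (+-cancelʳ-≡ 1 _ _ (begin
  y + 1                          ≡⟨ y+1≡x² ⟩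
  (1 + c * p) * (1 + c * p)      ≡⟨ solve c p ⟩
  c * (2 + c * p) * p + 1        ∎))
  where
  solve : ∀ c p → (1 + c * p) * (1 + c * p) ≡ c * (2 + c * p) * p + 1
  solve = solve-∀

odd-prime-half-pos : ∀ h → Prime (suc (h + h)) → 0 < h
odd-prime-half-pos zero pr = ⊥-elim (prime⇒≢1 pr refl)
odd-prime-half-pos (suc h) _ = z<s

odd-prime∤2 : ∀ h → Prime (suc (h + h)) → ¬ suc (h + h) ∣ 2
odd-prime∤2 h pr p∣2 = <⇒≱ (s≤s (+-mono-≤ 0<h 0<h)) (∣⇒≤ p∣2)
  where
  0<h : 0 < h
  0<h = odd-prime-half-pos h pr

odd-prime∣Pell-pred⊎Pell-suc : ∀ h → Prime (suc (h + h)) →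
  suc (h + h) ∣ Pell (h + h) ⊎ suc (h + h) ∣ Pell (suc h + suc h)
odd-prime∣Pell-pred⊎Pell-suc h pr = split (euclidsLemma 2 _ pr p∣2*Pell*Pell)
  where
  p = suc (h + h)
  p∣2*Pell*Pell : p ∣ 2 * (Pell (h + h) * Pell (suc p))
  p∣2*Pell*Pell = x≡1+c*p∧y+1≡x*x⇒p∣y {c = proj₁ (H-odd-prime h pr)} (proj₂ (H-odd-prime h pr)) (Pell-cassini-odd h)
  split : p ∣ 2 ⊎ p ∣ Pell (h + h) * Pell (suc p) → p ∣ Pell (h + h) ⊎ p ∣ Pell (suc h + suc h)
  split (inj₁ p∣2) = ⊥-elim (odd-prime∤2 h pr p∣2)
  split (inj₂ p∣Pell*Pell) =
    Sum.map₂ (subst (λ n → p ∣ Pell n) (cong suc (sym (+-suc h h)))) (euclidsLemma _ _ pr p∣Pell*Pell)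

order-of-appearance-below-double : ∀ {d z n} → IsOrderOfAppearance d z →
  d ∣ Pell n → 0 < n → n < z + z → n ≡ z
order-of-appearance-below-double {d} {z} {n} (_ , d∣Pell[z] , minimal) d∣Pell[n] 0<n n<2z with <-cmp n z
... | tri< n<z _ _ = ⊥-elim (minimal n 0<n n<z d∣Pell[n])
... | tri≈ _ n≡z _ = n≡z
... | tri> _ _ z<n = ⊥-elim (minimal k (m<n⇒0<n∸m z<n) k<z d∣Pell[k])
  where
  k = n ∸ z
  k+z≡n : k + z ≡ n
  k+z≡n = m∸n+n≡m (<⇒≤ z<n)
  k<z : k < z
  k<z = +-cancelʳ-< z k z (subst (_< z + z) (sym k+z≡n) n<2z)
  d∣Pell[k] : d ∣ Pell k
  d∣Pell[k] = Pell-∣-+ k d∣Pell[z] (subst (λ m → d ∣ Pell m) (sym k+z≡n) d∣Pell[n])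

prime-power-divisor : ∀ {p m n} e → Prime p → ¬ p ∣ m → p ^ e ∣ m * n → p ^ e ∣ n
prime-power-divisor zero _ _ _ = 1∣ _
prime-power-divisor {p} {m} {n} (suc e) pr p∤m pᵉ⁺¹∣mn
  with euclidsLemma m n pr (∣-trans (m∣m*n (p ^ e)) pᵉ⁺¹∣mn)
... | inj₁ p∣m = ⊥-elim (p∤m p∣m)
... | inj₂ (divides q refl) = subst (p ^ suc e ∣_) (*-comm p q) (*-monoʳ-∣ p pᵉ∣q)
  where
  instance _ = prime⇒nonZero pr
  pᵉ∣q : p ^ e ∣ q
  pᵉ∣q = prime-power-divisor e pr p∤m
    (*-cancelˡ-∣ p (subst (p ^ suc e ∣_) (solve m q p) pᵉ⁺¹∣mn))
    where
    solve : ∀ m q p → m * (q * p) ≡ p * (m * q)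
    solve = solve-∀

order-of-appearance-power≤H : ∀ {p z} e m → Prime p → ¬ p ∣ 2 → IsOrderOfAppearance p z →
  p ^ e ∣ Pell z → 0 < m → p ∣ Pell (m + m) → p ^ e ≤ H m
order-of-appearance-power≤H {p} {z} e m pr p∤2 ord@(0<z , _ , minimal) pᵉ∣Pell[z] 0<m p∣Pell[2m]
  with z ≤? m
... | yes z≤m = ≤-trans (∣⇒≤ {{>-nonZero (Pell-pos 0<z)}} pᵉ∣Pell[z]) (≤-trans (Pell-mono-≤ z≤m) (Pell≤H m))
... | no z≰m = ∣⇒≤ {{>-nonZero (H-pos m)}} pᵉ∣H[m]
  where
  m<z : m < z
  m<z = ≰⇒> z≰m
  2m≡z : m + m ≡ z
  2m≡z = order-of-appearance-below-double ord p∣Pell[2m] (<-≤-trans 0<m (m≤m+n m m)) (+-mono-< m<z m<z)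
  pᵉ∣Pell[m]*2H[m] : p ^ e ∣ Pell m * (2 * H m)
  pᵉ∣Pell[m]*2H[m] = subst (p ^ e ∣_) (trans (cong Pell (sym 2m≡z)) (Pell-double m)) pᵉ∣Pell[z]
  pᵉ∣H[m] : p ^ e ∣ H m
  pᵉ∣H[m] = prime-power-divisor e pr p∤2
    (prime-power-divisor e pr (minimal m 0<m m<z) pᵉ∣Pell[m]*2H[m])

^-double : ∀ p e → p ^ (2 * e) ≡ p ^ e * p ^ e
^-double p e = trans (cong (p ^_) (cong (e +_) (+-identityʳ e))) (^-distribˡ-+-* p e e)

power-double≤H : ∀ p e m n → p ^ e ≤ H m → m + m ≤ n → p ^ (2 * e) ≤ H n
power-double≤H p e m n pᵉ≤H[m] 2m≤n =
  subst (_≤ H n) (sym (^-double p e)) (≤-trans (*-mono-≤ pᵉ≤H[m] pᵉ≤H[m]) H[m]²≤H[n])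
  where
  H[m]²≤H[n] : H m * H m ≤ H n
  H[m]²≤H[n] = ≤-trans (subst (H m * H m ≤_) (sym (H-+ m m)) (m≤m+n _ _)) (H-mono-≤ 2m≤n)

odd-prime-bound : ∀ h {z} e → Prime (suc (h + h)) → IsOrderOfAppearance (suc (h + h)) z →
  suc (h + h) ^ e ∣ Pell z → suc (h + h) ^ (2 * e) ≤ H (suc (h + h) + 1)
odd-prime-bound h e pr ord pᵉ∣Pell[z] = bound (odd-prime∣Pell-pred⊎Pell-suc h pr)
  where
  p = suc (h + h)
  bound : p ∣ Pell (h + h) ⊎ p ∣ Pell (suc h + suc h) → p ^ (2 * e) ≤ H (p + 1)
  bound (inj₁ p∣Pell[p-1]) = power-double≤H p e h (p + 1)
    (order-of-appearance-power≤H e h pr (odd-prime∤2 h pr) ord pᵉ∣Pell[z] (odd-prime-half-pos h pr) p∣Pell[p-1])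
    (≤-trans (n≤1+n (h + h)) (m≤m+n p 1))
  bound (inj₂ p∣Pell[p+1]) = power-double≤H p e (suc h) (p + 1)
    (order-of-appearance-power≤H e (suc h) pr (odd-prime∤2 h pr) ord pᵉ∣Pell[z] z<s p∣Pell[p+1])
    (≤-reflexive (solve h))
    where
    solve : ∀ h → suc h + suc h ≡ suc (h + h) + 1
    solve = solve-∀

order-of-appearance[2] : ∀ {z} → IsOrderOfAppearance 2 z → z ≡ 2
order-of-appearance[2] {1} (_ , 2∣1 , _) = ⊥-elim (prime⇒≢1 prime[2] (∣1⇒≡1 2∣1))
order-of-appearance[2] {2} _ = refl
order-of-appearance[2] {suc (suc (suc z))} (_ , _ , minimal) = ⊥-elim (minimal 2 z<s (s≤s (s≤s z<s)) ∣-refl)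

two-power-bound : ∀ {k e} → IsOrderOfAppearance 2 k → 2 ^ e ∣ Pell k → 2 ^ (2 * e) ≤ H 3
two-power-bound {e = e} ord 2ᵉ∣Pell[k] with order-of-appearance[2] ord
... | refl = subst (_≤ H 3) (sym (^-double 2 e)) (≤-trans (*-mono-≤ 2ᵉ≤2 2ᵉ≤2) 4≤7)
  where
  2ᵉ≤2 : 2 ^ e ≤ 2
  2ᵉ≤2 = ∣⇒≤ 2ᵉ∣Pell[k]
  4≤7 : 4 ≤ 7
  4≤7 = s≤s (s≤s (s≤s (s≤s z≤n)))

data Parity : ℕ → Set where
  even : ∀ h → Parity (h + h)
  odd  : ∀ h → Parity (suc (h + h))

parity : ∀ n → Parity n
parity zero = even zero
parity (suc n) with parity n
... | even h = odd h
... | odd h = subst Parity (cong suc (+-suc h h)) (even (suc h))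

even-prime⇒half≡1 : ∀ h → Prime (h + h) → h ≡ 1
even-prime⇒half≡1 h pr with prime⇒irreducible pr (divides h (trans (cong (h +_) (sym (+-identityʳ h))) (*-comm 2 h)))
... | inj₁ ()
... | inj₂ 2≡h+h = *-cancelˡ-≡ h 1 2 (trans (cong (h +_) (+-identityʳ h)) (sym 2≡h+h))

lemma5 : ∀ (p : ℕ) → Prime p → ∀ (k : ℕ) → IsOrderOfAppearance p k →
    ∀ (e : ℕ) → IsValuation p (Pell k) e →
    (p ^ (2 * e)) ≤ℕ√2 alphaPow (p + 1)
lemma5 p pr k ord e (pᵉ∣Pell[k] , _) with parity p
... | even h with even-prime⇒half≡1 h pr
...   | refl = inj₁ (two-power-bound {e = e} ord pᵉ∣Pell[k])
lemma5 p pr k ord e (pᵉ∣Pell[k] , _) | odd h = inj₁ (odd-prime-bound h e pr ord pᵉ∣Pell[k])
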